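{- Let $C$ be an $8$-divisible binary linear code of effective length $65$, dimension $12$ and minimum distance $24$. Then $C$ contains no codeword of weight $64$ and no codeword of weight $56$.
   Context: A binary linear code is a subspace of $\mathbb{F}_2^n$, considered to be of full length (every coordinate is non-zero in some codeword), so $n$ is its effective length. The weight of a codeword is its number of non-zero entries; the code is $8$-divisible if all codeword weights are divisible by $8$; the minimum distance is the minimum weight of a non-zero codeword. -}

module Defs where

open import Data.Bool using (Bool; true; false; _∧_; _xor_)
open import Data.Nat using (ℕ; zero; suc; _+_; _≤_)
open import Data.Nat.Divisibility using (_∣_)
open import Data.Fin using (Fin; zero; suc)
open import Data.Product using (Σ; _×_; ∃)
open import Relation.Binary.PropositionalEquality using (_≡_)

-- Binary words of length n: vectors in F₂ⁿ (F₂ = Bool with xor as +, ∧ as ·).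
Word : ℕ → Set
Word n = Fin n → Bool

weight : ∀ {n} → Word n → ℕ
weight {zero}  w = 0
weight {suc n} w = (if-true (w zero)) + weight (λ j → w (suc j))
  where
  if-true : Bool → ℕ
  if-true true  = 1
  if-true false = 0

xorSum : ∀ {k} → (Fin k → Bool) → Bool
xorSum {zero}  f = false
xorSum {suc k} f = f zero xor xorSum (λ i → f (suc i))

-- A k × n generator matrix (rows = generators) and the encoding map
-- F₂ᵏ → F₂ⁿ, x ↦ x G.  The code generated by G is the image of this map.
GenMatrix : ℕ → ℕ → Set
GenMatrix k n = Fin k → Word n

encode : ∀ {k n} → GenMatrix k n → Word k → Word n
encode G x j = xorSum (λ i → x i ∧ G i j)

IsZero : ∀ {n} → Word n → Set
IsZero w = ∀ j → w j ≡ false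

NonZero : ∀ {n} → Word n → Set
NonZero w = ∃ λ j → w j ≡ true

-- The rows of G are linearly independent, i.e. the code it generates has
-- dimension exactly k.
Independent : ∀ {k n} → GenMatrix k n → Set
Independent G = ∀ x → IsZero (encode G x) → IsZero x

-- Full length: every coordinate is nonzero in some codeword
-- (so n is the effective length).
FullLength : ∀ {k n} → GenMatrix k n → Set
FullLength G = ∀ j → ∃ λ x → encode G x j ≡ true

Divisible : ℕ → ∀ {k n} → GenMatrix k n → Set
Divisible d G = ∀ x → d ∣ weight (encode G x)

MinDist : ℕ → ∀ {k n} → GenMatrix k n → Set
MinDist d G =
  (∀ x → NonZero (encode G x) → d ≤ weight (encode G x)) ×
  (∃ λ x → NonZero (encode G x) × weight (encode G x) ≡ d)

record DivCode (n k d : ℕ) : Set where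
  field
    gen         : GenMatrix k n
    independent : Independent gen
    fullLength  : FullLength gen
    divisible8  : Divisible 8 gen
    minDist     : MinDist d gen

module Submission where

-- Fix a codeword c₀ of weight w.  Since C is 8-divisible, |c ∖ c₀| = |c| − |c ∩ c₀| with
-- 2|c ∩ c₀| = |c| + |c₀| − |c + c₀| ≡ 0 (mod 8), so the residual code of C on the 65 − w
-- coordinates outside c₀ is doubly-even, and by full length every one of those coordinates
-- is covered.  Such a code cannot live on 1 or 9 points.  In a doubly-even code two codewords
-- meet evenly, so no codeword misses exactly one support point (a codeword covering that
-- point would have odd weight); this settles w = 64.  On 9 points every nonzero codeword
-- therefore has weight 4 and any two distinct ones meet in 2 points.  Two of them, a and b,
-- cover 6 points; a codeword meeting the other 3 meets each of a, b, a + b in 2 points,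
-- hence a ∪ b in 3 and the remaining points exactly once.  Two codewords meeting those
-- points at different places then sum to one meeting them twice: w = 56 is impossible too.

open import Defs
open import Data.Nat using (ℕ)
open import Relation.Binary.PropositionalEquality using (_≢_)
open import Data.Product using (_×_)

open import Algebra.Bundles using (CommutativeRing)
open import Data.Bool.Base using (Bool; true; false; not; _∧_; _∨_; _xor_)
open import Data.Bool.Properties
  using ( ∧-distribʳ-xor; xor-same; ∧-identityʳ; ∧-zeroʳ; ∧-conicalˡ; ∧-conicalʳ
        ; ∨-conicalˡ; ∨-conicalʳ; not-injective; xor-∧-commutativeRing)
open import Data.Empty using (⊥)
open import Data.Fin.Base using (Fin; zero; suc)
open import Data.Nat.Base using (zero; suc; _+_; _*_; _∸_; _≤_; _<_; s≤s; z<s)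
open import Data.Nat.Properties
  using ( +-*-semiring; +-suc; +-cancelˡ-≡; *-cancelˡ-≡; m≤m+n; m≤n+m; <-≤-trans; ≤-antisym
        ; m+n∸m≡n; even≢odd)
open import Data.Nat.Divisibility
  using (_∣_; _∤_; divides; ∣m+n∣m⇒∣n; ∣m∣n⇒∣m+n; *-cancelˡ-∣; ∣1⇒≡1; ∣-trans; n∣m*n)
open import Data.Product using (∃; _,_; proj₁; proj₂)
open import Function.Base using (_∘_; case_of_)
open import Relation.Binary.PropositionalEquality
  using (_≡_; refl; sym; trans; cong; cong₂; subst; subst₂; _≗_; module ≡-Reasoning)
import Algebra.Properties.CommutativeMonoid.Sum as CommutativeMonoidSum
import Algebra.Properties.Semiring.Sum as SemiringSum

module ℕ-Sum = SemiringSum +-*-semiring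
module ⊕-Sum = CommutativeMonoidSum (CommutativeRing.+-commutativeMonoid xor-∧-commutativeRing)

open ℕ-Sum using (sum; ∑-distrib-+; sum-cong-≗; *-distribˡ-sum)
open ≡-Reasoning

infixr 7 _∩_ _─_
infixr 6 _∪_ _⊕_
infix 4 _⊆_

_∩_ _∪_ _⊕_ _─_ : ∀ {n} → Word n → Word n → Word n
(f ∩ g) j = f j ∧ g j
(f ∪ g) j = f j ∨ g j
(f ⊕ g) j = f j xor g j
(f ─ g) j = f j ∧ not (g j)

∁ : ∀ {n} → Word n → Word n
∁ f j = not (f j)

_⊆_ : ∀ {n} → Word n → Word n → Set
f ⊆ g = ∀ j → f j ≡ true → g j ≡ true

∈─ : ∀ {n} {f g : Word n} j → (f ─ g) j ≡ true → f j ≡ true × g j ≡ false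
∈─ j e = ∧-conicalˡ _ _ e , not-injective (∧-conicalʳ _ _ e)

─⊆∁ : ∀ {n} (f g : Word n) → f ─ g ⊆ ∁ g
─⊆∁ f g j = ∧-conicalʳ _ _

─-monoˡ-⊆ : ∀ {n} {f g : Word n} h → f ⊆ g → f ─ h ⊆ g ─ h
─-monoˡ-⊆ {f = f} h f⊆g j e =
  let fj , hj = ∈─ {f = f} {h} j e in cong₂ (λ a b → a ∧ not b) (f⊆g j fj) hj

⊆⇒∩≗ : ∀ {n} {f g : Word n} → f ⊆ g → g ∩ f ≗ f
⊆⇒∩≗ {f = f} {g} f⊆g j with f j in fj
... | true  = cong (_∧ true) (f⊆g j fj)
... | false = ∧-zeroʳ (g j)

⊆⇒─∩≗ : ∀ {n} {f g : Word n} h → f ⊆ g → (g ─ h) ∩ f ≗ f ─ h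
⊆⇒─∩≗ {f = f} {g} h f⊆g j with f j in fj
... | true  = trans (cong (λ a → (a ∧ not (h j)) ∧ true) (f⊆g j fj)) (∧-identityʳ _)
... | false = ∧-zeroʳ _

[_] : Bool → ℕ
[ true ]  = 1
[ false ] = 0

weight-suc : ∀ {n} (f : Word (suc n)) → weight f ≡ [ f zero ] + weight (f ∘ suc)
weight-suc f with f zero
... | true  = refl
... | false = refl

weight≡sum : ∀ {n} (f : Word n) → weight f ≡ sum (λ j → [ f j ])
weight≡sum {zero}  f = refl
weight≡sum {suc n} f = trans (weight-suc f) (cong ([ f zero ] +_) (weight≡sum (f ∘ suc)))

weight-cong : ∀ {n} {f g : Word n} → f ≗ g → weight f ≡ weight g
weight-cong {f = f} {g} f≗g =
  trans (weight≡sum f) (trans (sum-cong-≗ (cong [_] ∘ f≗g)) (sym (weight≡sum g)))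

weight+weight≡sum : ∀ {n} (f g : Word n) → weight f + weight g ≡ sum (λ j → [ f j ] + [ g j ])
weight+weight≡sum f g =
  trans (cong₂ _+_ (weight≡sum f) (weight≡sum g)) (sym (∑-distrib-+ (λ j → [ f j ]) (λ j → [ g j ])))

2*weight≡sum : ∀ {n} (f : Word n) → 2 * weight f ≡ sum (λ j → 2 * [ f j ])
2*weight≡sum f = trans (cong (2 *_) (weight≡sum f)) (*-distribˡ-sum 2 (λ j → [ f j ]))

[∧]+[─] : ∀ a b → [ a ∧ b ] + [ a ∧ not b ] ≡ [ a ]
[∧]+[─] true  true  = refl
[∧]+[─] true  false = refl
[∧]+[─] false b     = refl

[xor]+2*[∧] : ∀ a b → [ a xor b ] + 2 * [ a ∧ b ] ≡ [ a ] + [ b ]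
[xor]+2*[∧] true  true  = refl
[xor]+2*[∧] true  false = refl
[xor]+2*[∧] false true  = refl
[xor]+2*[∧] false false = refl

[∧]+[∧]+[∧xor] : ∀ c a b → [ c ∧ a ] + [ c ∧ b ] + [ c ∧ (a xor b) ] ≡ 2 * [ c ∧ (a ∨ b) ]
[∧]+[∧]+[∧xor] true  true  true  = refl
[∧]+[∧]+[∧xor] true  true  false = refl
[∧]+[∧]+[∧xor] true  false true  = refl
[∧]+[∧]+[∧xor] true  false false = refl
[∧]+[∧]+[∧xor] false a     b     = refl

weight-∩+─ : ∀ {n} (f g : Word n) → weight (f ∩ g) + weight (f ─ g) ≡ weight f
weight-∩+─ f g = begin
  weight (f ∩ g) + weight (f ─ g)                   ≡⟨ weight+weight≡sum (f ∩ g) (f ─ g) ⟩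
  sum (λ j → [ f j ∧ g j ] + [ f j ∧ not (g j) ])  ≡⟨ sum-cong-≗ (λ j → [∧]+[─] (f j) (g j)) ⟩
  sum (λ j → [ f j ])                               ≡⟨ weight≡sum f ⟨
  weight f                                          ∎

weight-⊕ : ∀ {n} (f g : Word n) → weight (f ⊕ g) + 2 * weight (f ∩ g) ≡ weight f + weight g
weight-⊕ f g = begin
  weight (f ⊕ g) + 2 * weight (f ∩ g)
    ≡⟨ cong₂ _+_ (weight≡sum (f ⊕ g)) (2*weight≡sum (f ∩ g)) ⟩
  sum (λ j → [ f j xor g j ]) + sum (λ j → 2 * [ f j ∧ g j ])
    ≡⟨ ∑-distrib-+ (λ j → [ f j xor g j ]) (λ j → 2 * [ f j ∧ g j ]) ⟨
  sum (λ j → [ f j xor g j ] + 2 * [ f j ∧ g j ])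
    ≡⟨ sum-cong-≗ (λ j → [xor]+2*[∧] (f j) (g j)) ⟩
  sum (λ j → [ f j ] + [ g j ])
    ≡⟨ weight+weight≡sum f g ⟨
  weight f + weight g ∎

weight-∩-∪ : ∀ {n} (h f g : Word n) →
  weight (h ∩ f) + weight (h ∩ g) + weight (h ∩ (f ⊕ g)) ≡ 2 * weight (h ∩ (f ∪ g))
weight-∩-∪ h f g = begin
  weight (h ∩ f) + weight (h ∩ g) + weight (h ∩ (f ⊕ g))
    ≡⟨ cong₂ _+_ (weight+weight≡sum (h ∩ f) (h ∩ g)) (weight≡sum (h ∩ (f ⊕ g))) ⟩
  sum (λ j → [ h j ∧ f j ] + [ h j ∧ g j ]) + sum (λ j → [ h j ∧ (f j xor g j) ])
    ≡⟨ ∑-distrib-+ (λ j → [ h j ∧ f j ] + [ h j ∧ g j ]) (λ j → [ h j ∧ (f j xor g j) ]) ⟨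
  sum (λ j → [ h j ∧ f j ] + [ h j ∧ g j ] + [ h j ∧ (f j xor g j) ])
    ≡⟨ sum-cong-≗ (λ j → [∧]+[∧]+[∧xor] (h j) (f j) (g j)) ⟩
  sum (λ j → 2 * [ h j ∧ (f j ∨ g j) ])
    ≡⟨ 2*weight≡sum (h ∩ (f ∪ g)) ⟨
  2 * weight (h ∩ (f ∪ g)) ∎

weight+weight-∁ : ∀ {n} (f : Word n) → weight f + weight (∁ f) ≡ n
weight+weight-∁ {zero}  f = refl
weight+weight-∁ {suc n} f with f zero | weight+weight-∁ (f ∘ suc)
... | true  | ih = cong suc ih
... | false | ih = trans (+-suc _ _) (cong suc ih)

weight-∁ : ∀ {n} (f : Word n) → weight (∁ f) ≡ n ∸ weight f
weight-∁ f = trans (sym (m+n∸m≡n (weight f) _)) (cong (_∸ weight f) (weight+weight-∁ f))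

weight-mono : ∀ {n} {f g : Word n} → f ⊆ g → weight f ≤ weight g
weight-mono {f = f} {g} f⊆g = subst₂ _≤_ (weight-cong (⊆⇒∩≗ f⊆g)) (weight-∩+─ g f) (m≤m+n _ _)

NonZero⇒weight>0 : ∀ {n} (f : Word n) → NonZero f → 0 < weight f
NonZero⇒weight>0 f (zero , f0) rewrite weight-suc f | f0 = z<s
NonZero⇒weight>0 f (suc j , fj) rewrite weight-suc f =
  <-≤-trans (NonZero⇒weight>0 (f ∘ suc) (j , fj)) (m≤n+m _ _)

weight>0⇒NonZero : ∀ {n} (f : Word n) → 0 < weight f → NonZero f
weight>0⇒NonZero {suc n} f p with f zero in f0
... | true  = zero , f0
... | false = let j , fj = weight>0⇒NonZero (f ∘ suc) p in suc j , fj

∣weight-∩ : ∀ {n} m (f g : Word n) →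
  2 * m ∣ weight f → 2 * m ∣ weight g → 2 * m ∣ weight (f ⊕ g) → m ∣ weight (f ∩ g)
∣weight-∩ m f g ∣f ∣g ∣f⊕g = *-cancelˡ-∣ 2
  (∣m+n∣m⇒∣n (subst (2 * m ∣_) (sym (weight-⊕ f g)) (∣m∣n⇒∣m+n ∣f ∣g)) ∣f⊕g)

∣weight-─ : ∀ {n} m (f g : Word n) →
  2 * m ∣ weight f → 2 * m ∣ weight g → 2 * m ∣ weight (f ⊕ g) → m ∣ weight (f ─ g)
∣weight-─ m f g ∣f ∣g ∣f⊕g = ∣m+n∣m⇒∣n
  (subst (m ∣_) (sym (weight-∩+─ f g)) (∣-trans (n∣m*n 2) ∣f))
  (∣weight-∩ m f g ∣f ∣g ∣f⊕g)

xorSum≡sum : ∀ {k} (f : Fin k → Bool) → xorSum f ≡ ⊕-Sum.sum f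
xorSum≡sum {zero}  f = refl
xorSum≡sum {suc k} f = cong (f zero xor_) (xorSum≡sum (f ∘ suc))

encode-⊕ : ∀ {k n} (G : GenMatrix k n) x y → encode G (x ⊕ y) ≗ encode G x ⊕ encode G y
encode-⊕ G x y j = begin
  xorSum (λ i → (x i xor y i) ∧ G i j)
    ≡⟨ xorSum≡sum (λ i → (x i xor y i) ∧ G i j) ⟩
  ⊕-Sum.sum (λ i → (x i xor y i) ∧ G i j)
    ≡⟨ ⊕-Sum.sum-cong-≗ (λ i → ∧-distribʳ-xor (G i j) (x i) (y i)) ⟩
  ⊕-Sum.sum (λ i → (x i ∧ G i j) xor (y i ∧ G i j))
    ≡⟨ ⊕-Sum.∑-distrib-+ (λ i → x i ∧ G i j) (λ i → y i ∧ G i j) ⟩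
  ⊕-Sum.sum (λ i → x i ∧ G i j) xor ⊕-Sum.sum (λ i → y i ∧ G i j)
    ≡⟨ cong₂ _xor_ (xorSum≡sum (λ i → x i ∧ G i j)) (xorSum≡sum (λ i → y i ∧ G i j)) ⟨
  encode G x j xor encode G y j ∎

2∤1 : 2 ∤ 1
2∤1 2∣1 with () ← ∣1⇒≡1 2∣1

4∣m⇒m≡4 : ∀ {m} → 4 ∣ m → 0 < m → m ≤ 9 → m ≢ 8 → m ≡ 4
4∣m⇒m≡4 (divides 0 refl) ()
4∣m⇒m≡4 (divides 1 refl) _ _ _ = refl
4∣m⇒m≡4 (divides 2 refl) _ _ m≢8 with () ← m≢8 refl
4∣m⇒m≡4 (divides (suc (suc (suc q))) refl) _ (s≤s (s≤s (s≤s (s≤s (s≤s (s≤s (s≤s (s≤s (s≤s ())))))))))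

module DoublyEvenCode {k n} (c : Word k → Word n) (supp : Word n)
  (c-⊕ : ∀ x y → c (x ⊕ y) ≗ c x ⊕ c y)
  (c⊆supp : ∀ x → c x ⊆ supp)
  (supp⊆⋃c : ∀ j → supp j ≡ true → ∃ λ x → c x j ≡ true)
  (4∣weight : ∀ x → 4 ∣ weight (c x))
  where

  c-0 : ∀ j → c (λ _ → false) j ≡ false
  c-0 j = trans (c-⊕ (λ _ → false) (λ _ → false) j) (xor-same (c (λ _ → false) j))

  nonzero-⊕ : ∀ {x y} j → c x j xor c y j ≡ true → NonZero (c (x ⊕ y))
  nonzero-⊕ {x} {y} j e = j , trans (c-⊕ x y j) e

  2∣weight-∩ : ∀ x y → 2 ∣ weight (c x ∩ c y)
  2∣weight-∩ x y = ∣weight-∩ 2 (c x) (c y) (4∣weight x) (4∣weight y)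
    (subst (4 ∣_) (weight-cong (c-⊕ x y)) (4∣weight (x ⊕ y)))

  weight-supp∩ : ∀ x → weight (supp ∩ c x) ≡ weight (c x)
  weight-supp∩ x = weight-cong (⊆⇒∩≗ (c⊆supp x))

  weight+weight-supp─ : ∀ x → weight (c x) + weight (supp ─ c x) ≡ weight supp
  weight+weight-supp─ x =
    trans (cong (_+ weight (supp ─ c x)) (sym (weight-supp∩ x))) (weight-∩+─ supp (c x))

  weight-supp─≢1 : ∀ x → weight (supp ─ c x) ≢ 1
  weight-supp─≢1 x w≡1
    with j , j∈supp─x ← weight>0⇒NonZero (supp ─ c x) (subst (0 <_) (sym w≡1) z<s)
    with supp-j , x-j ← ∈─ {f = supp} {c x} j j∈supp─x
    with y , y-j ← supp⊆⋃c j supp-j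
    = 2∤1 (∣m+n∣m⇒∣n 2∣y∩x+1 (2∣weight-∩ y x))
    where
    weight-y─x : weight (c y ─ c x) ≡ 1
    weight-y─x = ≤-antisym
      (subst (_ ≤_) w≡1 (weight-mono (─-monoˡ-⊆ (c x) (c⊆supp y))))
      (NonZero⇒weight>0 (c y ─ c x) (j , cong₂ (λ a b → a ∧ not b) y-j x-j))
    2∣y∩x+1 : 2 ∣ weight (c y ∩ c x) + 1
    2∣y∩x+1 = subst (2 ∣_)
      (trans (sym (weight-∩+─ (c y) (c x))) (cong (weight (c y ∩ c x) +_) weight-y─x))
      (∣-trans (divides 2 refl) (4∣weight y))

  weight-supp≢1 : weight supp ≢ 1
  weight-supp≢1 = weight-supp─≢1 (λ _ → false) ∘
    trans (weight-cong (λ j → trans (cong (λ b → supp j ∧ not b) (c-0 j)) (∧-identityʳ (supp j))))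

  module _ (weight-supp≡9 : weight supp ≡ 9) where

    weight≡4 : ∀ {x} → NonZero (c x) → weight (c x) ≡ 4
    weight≡4 {x} x≢0 = 4∣m⇒m≡4 (4∣weight x) (NonZero⇒weight>0 (c x) x≢0) weight≤9 weight≢8
      where
      weight+weight-supp─≡9 : weight (c x) + weight (supp ─ c x) ≡ 9
      weight+weight-supp─≡9 = trans (weight+weight-supp─ x) weight-supp≡9
      weight≤9 : weight (c x) ≤ 9
      weight≤9 = subst (weight (c x) ≤_) weight+weight-supp─≡9 (m≤m+n _ _)
      weight≢8 : weight (c x) ≢ 8
      weight≢8 w≡8 = weight-supp─≢1 x
        (+-cancelˡ-≡ 8 _ 1 (trans (cong (_+ weight (supp ─ c x)) (sym w≡8)) weight+weight-supp─≡9))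

    weight-∩≡2 : ∀ {x y} → NonZero (c x) → NonZero (c y) → NonZero (c (x ⊕ y)) →
                 weight (c x ∩ c y) ≡ 2
    weight-∩≡2 {x} {y} x≢0 y≢0 x⊕y≢0 = *-cancelˡ-≡ _ 2 2 (+-cancelˡ-≡ 4 _ _ (begin
      4 + 2 * weight (c x ∩ c y)                   ≡⟨ cong (_+ 2 * weight (c x ∩ c y)) weight-x⊕y ⟨
      weight (c x ⊕ c y) + 2 * weight (c x ∩ c y)  ≡⟨ weight-⊕ (c x) (c y) ⟩
      weight (c x) + weight (c y)                  ≡⟨ cong₂ _+_ (weight≡4 x≢0) (weight≡4 y≢0) ⟩
      8                                            ∎))
      where
      weight-x⊕y : weight (c x ⊕ c y) ≡ 4
      weight-x⊕y = trans (sym (weight-cong (c-⊕ x y))) (weight≡4 x⊕y≢0)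

    weight-supp─≡5 : ∀ {x} → NonZero (c x) → weight (supp ─ c x) ≡ 5
    weight-supp─≡5 {x} x≢0 = +-cancelˡ-≡ 4 _ 5 (begin
      4 + weight (supp ─ c x)             ≡⟨ cong (_+ weight (supp ─ c x)) (weight≡4 x≢0) ⟨
      weight (c x) + weight (supp ─ c x)  ≡⟨ weight+weight-supp─ x ⟩
      weight supp                         ≡⟨ weight-supp≡9 ⟩
      9                                   ∎)

    nonzero-partner : ∀ {a} → NonZero (c a) → ∃ λ b → NonZero (c b) × NonZero (c (a ⊕ b))
    nonzero-partner {a} a≢0 =
      case weight>0⇒NonZero (supp ─ c a) (subst (0 <_) (sym (weight-supp─≡5 a≢0)) z<s) of λ where
        (j , j∈supp─a) → case supp⊆⋃c j (proj₁ (∈─ {f = supp} {c a} j j∈supp─a)) of λ where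
          (b , b-j) → b , (j , b-j) ,
                      nonzero-⊕ j (cong₂ _xor_ (proj₂ (∈─ {f = supp} {c a} j j∈supp─a)) b-j)

    module _ {a b} (a≢0 : NonZero (c a)) (b≢0 : NonZero (c b)) (a⊕b≢0 : NonZero (c (a ⊕ b))) where

      outside : Word n
      outside = supp ─ (c a ∪ c b)

      weight-∩-∪-pair : ∀ h → weight (h ∩ c a) + weight (h ∩ c b) + weight (h ∩ c (a ⊕ b)) ≡
                              2 * weight (h ∩ (c a ∪ c b))
      weight-∩-∪-pair h = trans
        (cong (weight (h ∩ c a) + weight (h ∩ c b) +_) (weight-cong (λ j → cong (h j ∧_) (c-⊕ a b j))))
        (weight-∩-∪ h (c a) (c b))

      weight-outside : weight outside ≡ 3
      weight-outside = +-cancelˡ-≡ 6 _ 3 (trans (cong (_+ weight outside) weight-supp∩∪)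
                                              (trans (weight-∩+─ supp (c a ∪ c b)) weight-supp≡9))
        where
        weight-supp∩∪ : 6 ≡ weight (supp ∩ (c a ∪ c b))
        weight-supp∩∪ = *-cancelˡ-≡ 6 _ 2 (begin
          12  ≡⟨ cong₂ _+_ (cong₂ _+_ (weight≡4 a≢0) (weight≡4 b≢0)) (weight≡4 a⊕b≢0) ⟨
          weight (c a) + weight (c b) + weight (c (a ⊕ b))
            ≡⟨ cong₂ _+_ (cong₂ _+_ (weight-supp∩ a) (weight-supp∩ b)) (weight-supp∩ (a ⊕ b)) ⟨
          weight (supp ∩ c a) + weight (supp ∩ c b) + weight (supp ∩ c (a ⊕ b))
            ≡⟨ weight-∩-∪-pair supp ⟩
          2 * weight (supp ∩ (c a ∪ c b)) ∎)

      weight-outside∩≡1 : ∀ {z j} → outside j ≡ true → c z j ≡ true → weight (outside ∩ c z) ≡ 1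
      weight-outside∩≡1 {z} {j} out-j z-j = +-cancelˡ-≡ 3 _ 1 (begin
        3 + weight (outside ∩ c z)
          ≡⟨ cong₂ _+_ weight-z∩∪ (sym (weight-cong (⊆⇒─∩≗ (c a ∪ c b) (c⊆supp z)))) ⟨
        weight (c z ∩ (c a ∪ c b)) + weight (c z ─ (c a ∪ c b))
          ≡⟨ weight-∩+─ (c z) (c a ∪ c b) ⟩
        weight (c z)
          ≡⟨ weight≡4 (j , z-j) ⟩
        4 ∎)
        where
        a∪b-j : c a j ∨ c b j ≡ false
        a∪b-j = proj₂ (∈─ {f = supp} {c a ∪ c b} j out-j)
        a-j : c a j ≡ false
        a-j = ∨-conicalˡ _ _ a∪b-j
        b-j : c b j ≡ false
        b-j = ∨-conicalʳ _ _ a∪b-j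
        a⊕b-j : c (a ⊕ b) j ≡ false
        a⊕b-j = trans (c-⊕ a b j) (cong₂ _xor_ a-j b-j)
        z∩≡2 : ∀ {y} → NonZero (c y) → c y j ≡ false → weight (c z ∩ c y) ≡ 2
        z∩≡2 y≢0 y-j = weight-∩≡2 (j , z-j) y≢0 (nonzero-⊕ j (cong₂ _xor_ z-j y-j))
        weight-z∩∪ : weight (c z ∩ (c a ∪ c b)) ≡ 3
        weight-z∩∪ = *-cancelˡ-≡ _ 3 2 (begin
          2 * weight (c z ∩ (c a ∪ c b))  ≡⟨ weight-∩-∪-pair (c z) ⟨
          weight (c z ∩ c a) + weight (c z ∩ c b) + weight (c z ∩ c (a ⊕ b))
            ≡⟨ cong₂ _+_ (cong₂ _+_ (z∩≡2 a≢0 a-j) (z∩≡2 b≢0 b-j)) (z∩≡2 a⊕b≢0 a⊕b-j) ⟩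
          6                               ∎)

      weight-outside─≡2 : ∀ {z j} → outside j ≡ true → c z j ≡ true → weight (outside ─ c z) ≡ 2
      weight-outside─≡2 {z} out-j z-j = +-cancelˡ-≡ 1 _ 2 (begin
        1 + weight (outside ─ c z)
          ≡⟨ cong (_+ weight (outside ─ c z)) (weight-outside∩≡1 out-j z-j) ⟨
        weight (outside ∩ c z) + weight (outside ─ c z)
          ≡⟨ weight-∩+─ outside (c z) ⟩
        weight outside
          ≡⟨ weight-outside ⟩
        3 ∎)

      ¬meet-outside-apart : ∀ {d₁ d₂ k₁ k₂} → outside k₁ ≡ true → c d₁ k₁ ≡ true →
                            outside k₂ ≡ true → c d₁ k₂ ≡ false → c d₂ k₂ ≡ true → ⊥
      ¬meet-outside-apart {d₁} {d₂} {k₁} {k₂} out-k₁ d₁-k₁ out-k₂ d₁-k₂ d₂-k₂ =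
        even≢odd (weight (outside ∩ (c d₁ ∪ c d₂))) 1 (sym (begin
          3 ≡⟨ cong₂ _+_ (cong₂ _+_ (weight-outside∩≡1 out-k₁ d₁-k₁) (weight-outside∩≡1 out-k₂ d₂-k₂))
                         (weight-outside∩≡1 out-k₂ d₁⊕d₂-k₂) ⟨
          weight (outside ∩ c d₁) + weight (outside ∩ c d₂) + weight (outside ∩ c (d₁ ⊕ d₂))
            ≡⟨ cong (weight (outside ∩ c d₁) + weight (outside ∩ c d₂) +_)
                    (weight-cong (λ j → cong (outside j ∧_) (c-⊕ d₁ d₂ j))) ⟩
          weight (outside ∩ c d₁) + weight (outside ∩ c d₂) + weight (outside ∩ (c d₁ ⊕ c d₂))
            ≡⟨ weight-∩-∪ outside (c d₁) (c d₂) ⟩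
          2 * weight (outside ∩ (c d₁ ∪ c d₂)) ∎))
        where
        d₁⊕d₂-k₂ : c (d₁ ⊕ d₂) k₂ ≡ true
        d₁⊕d₂-k₂ = trans (c-⊕ d₁ d₂ k₂) (cong₂ _xor_ d₁-k₂ d₂-k₂)

      ¬meet-outside : ∀ {d₁ k₁} → outside k₁ ≡ true → c d₁ k₁ ≡ true → ⊥
      ¬meet-outside {d₁} out-k₁ d₁-k₁ =
        case weight>0⇒NonZero (outside ─ c d₁)
               (subst (0 <_) (sym (weight-outside─≡2 out-k₁ d₁-k₁)) z<s) of λ where
          (k₂ , k₂∈out─d₁) → case supp⊆⋃c k₂ (∧-conicalˡ _ _ (∧-conicalˡ _ _ k₂∈out─d₁)) of λ where
            (d₂ , d₂-k₂) → ¬meet-outside-apart out-k₁ d₁-k₁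
                             (proj₁ (∈─ {f = outside} {c d₁} k₂ k₂∈out─d₁))
                             (proj₂ (∈─ {f = outside} {c d₁} k₂ k₂∈out─d₁)) d₂-k₂

      ¬nonzero-pair : ⊥
      ¬nonzero-pair =
        case weight>0⇒NonZero outside (subst (0 <_) (sym weight-outside) z<s) of λ where
          (k₁ , out-k₁) → case supp⊆⋃c k₁ (∧-conicalˡ _ _ out-k₁) of λ where
            (d₁ , d₁-k₁) → ¬meet-outside out-k₁ d₁-k₁

  weight-supp≢9 : weight supp ≢ 9
  weight-supp≢9 w≡9 =
    case weight>0⇒NonZero supp (subst (0 <_) (sym w≡9) z<s) of λ where
      (j , supp-j) → case supp⊆⋃c j supp-j of λ where
        (a , a-j) → case nonzero-partner w≡9 (j , a-j) of λ where
          (b , b≢0 , a⊕b≢0) → ¬nonzero-pair w≡9 (j , a-j) b≢0 a⊕b≢0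

-- The residual code of C with respect to c₀ is kept at length n: its words are c ─ c₀,
-- supported on ∁ c₀.
module Residual {k n} (G : GenMatrix k n) (full : FullLength G) (8∣weight : Divisible 8 G)
  (x₀ : Word k) where

  residual : Word k → Word n
  residual x = encode G x ─ encode G x₀

  residual-⊕ : ∀ x y → residual (x ⊕ y) ≗ residual x ⊕ residual y
  residual-⊕ x y j = trans (cong (_∧ not (encode G x₀ j)) (encode-⊕ G x y j))
                           (∧-distribʳ-xor (not (encode G x₀ j)) (encode G x j) (encode G y j))

  ∁⊆⋃residual : ∀ j → ∁ (encode G x₀) j ≡ true → ∃ λ x → residual x j ≡ true
  ∁⊆⋃residual j x₀-j = case full j of λ where
    (x , x-j) → x , cong₂ _∧_ x-j x₀-j

  4∣weight-residual : ∀ x → 4 ∣ weight (residual x)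
  4∣weight-residual x = ∣weight-─ 4 (encode G x) (encode G x₀) (8∣weight x) (8∣weight x₀)
    (subst (8 ∣_) (weight-cong (encode-⊕ G x x₀)) (8∣weight (x ⊕ x₀)))

  open DoublyEvenCode residual (∁ (encode G x₀)) residual-⊕ (λ x → ─⊆∁ (encode G x) (encode G x₀))
    ∁⊆⋃residual 4∣weight-residual public
    using (weight-supp≢1; weight-supp≢9)

lemma2 : (C : DivCode 65 12 24) →
    ∀ x → weight (encode (DivCode.gen C) x) ≢ 64 × weight (encode (DivCode.gen C) x) ≢ 56
lemma2 C x = weight-supp≢1 ∘ weight-∁≡ , weight-supp≢9 ∘ weight-∁≡
  where
  open DivCode C using (gen; fullLength; divisible8)
  open Residual gen fullLength divisible8 x
  weight-∁≡ : ∀ {m} → weight (encode gen x) ≡ m → weight (∁ (encode gen x)) ≡ 65 ∸ m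
  weight-∁≡ w≡m = trans (weight-∁ (encode gen x)) (cong (65 ∸_) w≡m)
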